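{- Let $\Psi$ be a sublanguage of $\mathcal{L}$ containing $\backslash$. Then for every theory $T$ of the Hilbert system $\mathbf{e}\mathcal{FL}[\Psi]$, its Leibniz congruence is $\Omega T=\{\langle\varphi,\psi\rangle:\varphi\backslash\psi\in T\text{ and }\psi\backslash\varphi\in T\}$ (pairs of $\Psi$-formulas).
   Context: Let $\mathcal{L}$ be the propositional language with binary connectives $\vee,\wedge,*,\backslash,/$, unary connectives $\neg_r$ (right negation) and $\neg_l$ (left negation), and constants $0,1$; formulas are built from countably many variables. A sequent is $\Gamma\Rightarrow\Delta$ with $\Gamma$ a finite (possibly empty) sequence of formulas and $\Delta$ of length at most one ($\emptyset$ = empty sequence). The calculus $\mathbf{FL}$ has the structural axiom $\varphi\Rightarrow\varphi$ and rule (Cut): from $\Gamma\Rightarrow\varphi$ and $\Sigma,\varphi,\Pi\Rightarrow\Delta$ infer $\Sigma,\Gamma,\Pi\Rightarrow\Delta$; and the connective rules: ($\vee\Rightarrow$) from $\Sigma,\varphi,\Gamma\Rightarrow\Delta$ and $\Sigma,\psi,\Gamma\Rightarrow\Delta$ infer $\Sigma,\varphi\vee\psi,\Gamma\Rightarrow\Delta$; ($\Rightarrow\vee$) from $\Gamma\Rightarrow\varphi$ infer $\Gamma\Rightarrow\varphi\vee\psi$ and $\Gamma\Rightarrow\psi\vee\varphi$; ($\wedge\Rightarrow$) from $\Sigma,\varphi,\Gamma\Rightarrow\Delta$ infer $\Sigma,\varphi\wedge\psi,\Gamma\Rightarrow\Delta$ and $\Sigma,\psi\wedge\varphi,\Gamma\Rightarrow\Delta$;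 ($\Rightarrow\wedge$) from $\Gamma\Rightarrow\varphi$, $\Gamma\Rightarrow\psi$ infer $\Gamma\Rightarrow\varphi\wedge\psi$; ($*\Rightarrow$) from $\Sigma,\varphi,\psi,\Gamma\Rightarrow\Delta$ infer $\Sigma,\varphi*\psi,\Gamma\Rightarrow\Delta$; ($\Rightarrow*$) from $\Gamma\Rightarrow\varphi$, $\Pi\Rightarrow\psi$ infer $\Gamma,\Pi\Rightarrow\varphi*\psi$; ($\backslash\Rightarrow$) from $\Gamma\Rightarrow\varphi$ and $\Sigma,\psi,\Pi\Rightarrow\Delta$ infer $\Sigma,\Gamma,\varphi\backslash\psi,\Pi\Rightarrow\Delta$; ($\Rightarrow\backslash$) from $\varphi,\Gamma\Rightarrow\psi$ infer $\Gamma\Rightarrow\varphi\backslash\psi$; ($/\Rightarrow$) from $\Gamma\Rightarrow\varphi$ and $\Sigma,\psi,\Pi\Rightarrow\Delta$ infer $\Sigma,\psi/\varphi,\Gamma,\Pi\Rightarrow\Delta$; ($\Rightarrow/$) from $\Gamma,\varphi\Rightarrow\psi$ infer $\Gamma\Rightarrow\psi/\varphi$; ($\neg_r\Rightarrow$) from $\Gamma\Rightarrow\varphi$ infer $\Gamma,\neg_r\varphi\Rightarrow\emptyset$; ($\Rightarrow\neg_r$) from $\varphi,\Gamma\Rightarrow\emptyset$ infer $\Gamma\Rightarrow\neg_r\varphi$; ($\neg_l\Rightarrow$) from $\Gamma\Rightarrow\varphi$ infer $\neg_l\varphi,\Gamma\Rightarrow\emptyset$; ($\Rightarrow\neg_l$)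 from $\Gamma,\varphi\Rightarrow\emptyset$ infer $\Gamma\Rightarrow\neg_l\varphi$; for $1$: axiom $\emptyset\Rightarrow1$ and rule from $\Sigma,\Gamma\Rightarrow\Delta$ infer $\Sigma,1,\Gamma\Rightarrow\Delta$; for $0$: axiom $0\Rightarrow\emptyset$ and rule from $\Gamma\Rightarrow\emptyset$ infer $\Gamma\Rightarrow0$. For a sublanguage $\Psi$, $\mathbf{FL}[\Psi]$ uses $\Psi$-formulas, the structural axiom and (Cut), and only the rules/axioms of connectives and constants in $\Psi$; the Gentzen system $\mathcal{FL}[\Psi]$: $\Phi\vdash\varsigma$ iff there is a finite sequence ending in $\varsigma$ each member of which is an axiom instance, in $\Phi$, or obtained from earlier members by a rule instance. The Hilbert system $\mathbf{e}\mathcal{FL}[\Psi]$ on $\Psi$-formulas: $\Sigma\vdash\varphi$ iff $\{\emptyset\Rightarrow\psi:\psi\in\Sigma\}\vdash_{\mathcal{FL}[\Psi]}\emptyset\Rightarrow\varphi$. A theory is a set $T$ of formulas closed under $\vdash$. Its Leibniz congruence $\Omega T$ is the largest congruence $\theta$ of the $\Psi$-formula algebra compatible with $T$ (i.e. $\langle\varphi,\psi\rangle\in\theta$ and $\varphi\in T$ imply $\psi\in T$). -}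

module Defs where

open import Data.Nat using (ℕ)
open import Data.Bool using (Bool; T)
open import Data.List using (List; []; _∷_; [_]; _++_)
open import Data.Maybe using (Maybe; just; nothing)
open import Data.Product using (Σ; _×_; ∃)
open import Relation.Binary.PropositionalEquality using (_≡_)
open import Relation.Binary.Structures using (IsEquivalence)

record Lang : Set where
  field
    has∨ has∧ has* hasLdiv has/ has¬r has¬l has0 has1 : Bool
open Lang public

data Fm (Ψ : Lang) : Set where
  var  : ℕ → Fm Ψ
  or   : T (has∨ Ψ) → Fm Ψ → Fm Ψ → Fm Ψ
  and  : T (has∧ Ψ) → Fm Ψ → Fm Ψ → Fm Ψ
  prod : T (has* Ψ) → Fm Ψ → Fm Ψ → Fm Ψ
  ldiv : T (hasLdiv Ψ) → Fm Ψ → Fm Ψ → Fm Ψ   -- ldiv p φ ψ  =  φ \ ψ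
  rdiv : T (has/ Ψ) → Fm Ψ → Fm Ψ → Fm Ψ   -- rdiv p ψ φ  =  ψ / φ
  negr : T (has¬r Ψ) → Fm Ψ → Fm Ψ
  negl : T (has¬l Ψ) → Fm Ψ → Fm Ψ
  zer  : T (has0 Ψ) → Fm Ψ
  one  : T (has1 Ψ) → Fm Ψ

record Seq (Ψ : Lang) : Set where
  constructor _⇒_
  field
    ante : List (Fm Ψ)
    succ : Maybe (Fm Ψ)

infix 4 _⇒_

-- Derivability in the Gentzen system FL[Ψ] from a set Φ of sequents
-- (inductive form of "finite sequence of axioms / members of Φ / rule instances").
data _⊢G_ {Ψ : Lang} (Φ : Seq Ψ → Set) : Seq Ψ → Set where
  hyp  : ∀ {s} → Φ s → Φ ⊢G s
  ax   : ∀ φ → Φ ⊢G ([ φ ] ⇒ just φ)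
  cut  : ∀ {Γ Σ' Π Δ φ} → Φ ⊢G (Γ ⇒ just φ) → Φ ⊢G ((Σ' ++ φ ∷ Π) ⇒ Δ)
       → Φ ⊢G ((Σ' ++ Γ ++ Π) ⇒ Δ)
  ∨L   : ∀ {Σ' Γ Δ φ ψ} (p : T (has∨ Ψ))
       → Φ ⊢G ((Σ' ++ φ ∷ Γ) ⇒ Δ) → Φ ⊢G ((Σ' ++ ψ ∷ Γ) ⇒ Δ)
       → Φ ⊢G ((Σ' ++ or p φ ψ ∷ Γ) ⇒ Δ)
  ∨R₁  : ∀ {Γ φ} ψ (p : T (has∨ Ψ)) → Φ ⊢G (Γ ⇒ just φ) → Φ ⊢G (Γ ⇒ just (or p φ ψ))
  ∨R₂  : ∀ {Γ φ} ψ (p : T (has∨ Ψ)) → Φ ⊢G (Γ ⇒ just φ) → Φ ⊢G (Γ ⇒ just (or p ψ φ))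
  ∧L₁  : ∀ {Σ' Γ Δ φ} ψ (p : T (has∧ Ψ))
       → Φ ⊢G ((Σ' ++ φ ∷ Γ) ⇒ Δ) → Φ ⊢G ((Σ' ++ and p φ ψ ∷ Γ) ⇒ Δ)
  ∧L₂  : ∀ {Σ' Γ Δ φ} ψ (p : T (has∧ Ψ))
       → Φ ⊢G ((Σ' ++ φ ∷ Γ) ⇒ Δ) → Φ ⊢G ((Σ' ++ and p ψ φ ∷ Γ) ⇒ Δ)
  ∧R   : ∀ {Γ φ ψ} (p : T (has∧ Ψ))
       → Φ ⊢G (Γ ⇒ just φ) → Φ ⊢G (Γ ⇒ just ψ) → Φ ⊢G (Γ ⇒ just (and p φ ψ))
  *L   : ∀ {Σ' Γ Δ φ ψ} (p : T (has* Ψ))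
       → Φ ⊢G ((Σ' ++ φ ∷ ψ ∷ Γ) ⇒ Δ) → Φ ⊢G ((Σ' ++ prod p φ ψ ∷ Γ) ⇒ Δ)
  *R   : ∀ {Γ Π φ ψ} (p : T (has* Ψ))
       → Φ ⊢G (Γ ⇒ just φ) → Φ ⊢G (Π ⇒ just ψ) → Φ ⊢G ((Γ ++ Π) ⇒ just (prod p φ ψ))
  ldivL : ∀ {Γ Σ' Π Δ φ ψ} (p : T (hasLdiv Ψ))
       → Φ ⊢G (Γ ⇒ just φ) → Φ ⊢G ((Σ' ++ ψ ∷ Π) ⇒ Δ)
       → Φ ⊢G ((Σ' ++ Γ ++ ldiv p φ ψ ∷ Π) ⇒ Δ)
  ldivR : ∀ {Γ φ ψ} (p : T (hasLdiv Ψ))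
       → Φ ⊢G ((φ ∷ Γ) ⇒ just ψ) → Φ ⊢G (Γ ⇒ just (ldiv p φ ψ))
  /L   : ∀ {Γ Σ' Π Δ φ ψ} (p : T (has/ Ψ))
       → Φ ⊢G (Γ ⇒ just φ) → Φ ⊢G ((Σ' ++ ψ ∷ Π) ⇒ Δ)
       → Φ ⊢G ((Σ' ++ rdiv p ψ φ ∷ Γ ++ Π) ⇒ Δ)
  /R   : ∀ {Γ φ ψ} (p : T (has/ Ψ))
       → Φ ⊢G ((Γ ++ [ φ ]) ⇒ just ψ) → Φ ⊢G (Γ ⇒ just (rdiv p ψ φ))
  ¬rL  : ∀ {Γ φ} (p : T (has¬r Ψ))
       → Φ ⊢G (Γ ⇒ just φ) → Φ ⊢G ((Γ ++ [ negr p φ ]) ⇒ nothing)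
  ¬rR  : ∀ {Γ φ} (p : T (has¬r Ψ))
       → Φ ⊢G ((φ ∷ Γ) ⇒ nothing) → Φ ⊢G (Γ ⇒ just (negr p φ))
  ¬lL  : ∀ {Γ φ} (p : T (has¬l Ψ))
       → Φ ⊢G (Γ ⇒ just φ) → Φ ⊢G ((negl p φ ∷ Γ) ⇒ nothing)
  ¬lR  : ∀ {Γ φ} (p : T (has¬l Ψ))
       → Φ ⊢G ((Γ ++ [ φ ]) ⇒ nothing) → Φ ⊢G (Γ ⇒ just (negl p φ))
  1ax  : (p : T (has1 Ψ)) → Φ ⊢G ([] ⇒ just (one p))
  1L   : ∀ {Σ' Γ Δ} (p : T (has1 Ψ))
       → Φ ⊢G ((Σ' ++ Γ) ⇒ Δ) → Φ ⊢G ((Σ' ++ one p ∷ Γ) ⇒ Δ)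
  0ax  : (p : T (has0 Ψ)) → Φ ⊢G ([ zer p ] ⇒ nothing)
  0R   : ∀ {Γ} (p : T (has0 Ψ))
       → Φ ⊢G (Γ ⇒ nothing) → Φ ⊢G (Γ ⇒ just (zer p))

-- Hilbert system eFL[Ψ]:  Σ ⊢ φ  iff  {∅ ⇒ ψ : ψ ∈ Σ} ⊢_{FL[Ψ]} ∅ ⇒ φ
_⊢H_ : {Ψ : Lang} → (Fm Ψ → Set) → Fm Ψ → Set
_⊢H_ {Ψ} Σ' φ = (λ (s : Seq Ψ) → ∃ λ ψ → Σ' ψ × (s ≡ ([] ⇒ just ψ))) ⊢G ([] ⇒ just φ)

IsTheory : {Ψ : Lang} → (Fm Ψ → Set) → Set
IsTheory {Ψ} Th = ∀ (φ : Fm Ψ) → Th ⊢H φ → Th φ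

record IsCongruence {Ψ : Lang} (θ : Fm Ψ → Fm Ψ → Set) : Set where
  field
    isEquivalence : IsEquivalence θ
    cong-or   : ∀ p {a a' b b'} → θ a a' → θ b b' → θ (or p a b) (or p a' b')
    cong-and  : ∀ p {a a' b b'} → θ a a' → θ b b' → θ (and p a b) (and p a' b')
    cong-prod : ∀ p {a a' b b'} → θ a a' → θ b b' → θ (prod p a b) (prod p a' b')
    cong-ldiv : ∀ p {a a' b b'} → θ a a' → θ b b' → θ (ldiv p a b) (ldiv p a' b')
    cong-rdiv : ∀ p {a a' b b'} → θ a a' → θ b b' → θ (rdiv p a b) (rdiv p a' b')
    cong-negr : ∀ p {a a'} → θ a a' → θ (negr p a) (negr p a')
    cong-negl : ∀ p {a a'} → θ a a' → θ (negl p a) (negl p a')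

Compatible : {Ψ : Lang} → (Fm Ψ → Set) → (Fm Ψ → Fm Ψ → Set) → Set
Compatible {Ψ} Th θ = ∀ {φ ψ : Fm Ψ} → θ φ ψ → Th φ → Th ψ

IsLeibnizCongruence : {Ψ : Lang} → (Fm Ψ → Set) → (Fm Ψ → Fm Ψ → Set) → Set₁
IsLeibnizCongruence {Ψ} Th θ =
  IsCongruence θ × Compatible Th θ
  × (∀ (θ' : Fm Ψ → Fm Ψ → Set) → IsCongruence θ' → Compatible Th θ'
       → ∀ {φ ψ} → θ' φ ψ → θ φ ψ)

-- In FL with \, a theory T proves φ \ ψ exactly when the sequent φ ⇒ ψ is derivable from T
-- (rules \R and \L with cut).  Every connective is monotone or antitone for this preorder,
-- so mutual derivability is a congruence, and modus ponens makes it compatible with T.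
-- Conversely, a congruence θ compatible with T relating φ and ψ relates φ \ φ ∈ T to φ \ ψ,
-- which is therefore in T.
module Submission where

open import Defs
open import Data.Bool using (T)
open import Data.Product using (_×_; _,_; ∃; map)
open import Data.List using ([]; [_])
open import Data.Maybe using (just)
open import Function using (_⇔_; mk⇔)
open import Function.Bundles using (module Equivalence)
open import Relation.Binary.PropositionalEquality as ≡ using (_≡_)
open import Relation.Binary.Structures using (IsEquivalence)

module Derivability {Ψ : Lang} (Φ : Seq Ψ → Set) where

  infix 4 _⊑_ _≋_

  _⊑_ : Fm Ψ → Fm Ψ → Set
  a ⊑ b = Φ ⊢G ([ a ] ⇒ just b)

  _≋_ : Fm Ψ → Fm Ψ → Set
  a ≋ b = a ⊑ b × b ⊑ a

  ⊑-trans : ∀ {a b c} → a ⊑ b → b ⊑ c → a ⊑ c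
  ⊑-trans = cut {Σ' = []} {Π = []}

  modus-ponens : ∀ {a b} → Φ ⊢G ([] ⇒ just a) → a ⊑ b → Φ ⊢G ([] ⇒ just b)
  modus-ponens = cut {Σ' = []} {Π = []}

  ldiv⇒⊑ : ∀ {a b} (p : T (hasLdiv Ψ)) → Φ ⊢G ([] ⇒ just (ldiv p a b)) → a ⊑ b
  ldiv⇒⊑ {a} {b} p d =
    cut {Σ' = [ a ]} {Π = []} d (ldivL {Σ' = []} {Π = []} p (ax a) (ax b))

  or-mono : ∀ p {a a' b b'} → a ⊑ a' → b ⊑ b' → or p a b ⊑ or p a' b'
  or-mono p a⊑a' b⊑b' = ∨L {Σ' = []} {Γ = []} p (∨R₁ _ p a⊑a') (∨R₂ _ p b⊑b')

  and-mono : ∀ p {a a' b b'} → a ⊑ a' → b ⊑ b' → and p a b ⊑ and p a' b'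
  and-mono p a⊑a' b⊑b' =
    ∧R p (∧L₁ {Σ' = []} {Γ = []} _ p a⊑a') (∧L₂ {Σ' = []} {Γ = []} _ p b⊑b')

  prod-mono : ∀ p {a a' b b'} → a ⊑ a' → b ⊑ b' → prod p a b ⊑ prod p a' b'
  prod-mono p a⊑a' b⊑b' = *L {Σ' = []} {Γ = []} p (*R p a⊑a' b⊑b')

  ldiv-mono : ∀ p {a a' b b'} → a' ⊑ a → b ⊑ b' → ldiv p a b ⊑ ldiv p a' b'
  ldiv-mono p a'⊑a b⊑b' = ldivR p (ldivL {Γ = [ _ ]} {Σ' = []} {Π = []} p a'⊑a b⊑b')

  rdiv-mono : ∀ p {a a' b b'} → a ⊑ a' → b' ⊑ b → rdiv p a b ⊑ rdiv p a' b'
  rdiv-mono p a⊑a' b'⊑b = /R p (/L {Γ = [ _ ]} {Σ' = []} {Π = []} p b'⊑b a⊑a')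

  negr-anti : ∀ p {a a'} → a' ⊑ a → negr p a ⊑ negr p a'
  negr-anti p a'⊑a = ¬rR p (¬rL {Γ = [ _ ]} p a'⊑a)

  negl-anti : ∀ p {a a'} → a' ⊑ a → negl p a ⊑ negl p a'
  negl-anti p a'⊑a = ¬lR p (¬lL {Γ = [ _ ]} p a'⊑a)

  ≋-isCongruence : IsCongruence _≋_
  ≋-isCongruence = record
    { isEquivalence = record
      { refl  = λ {a} → ax a , ax a
      ; sym   = λ (a⊑b , b⊑a) → b⊑a , a⊑b
      ; trans = λ (a⊑b , b⊑a) (b⊑c , c⊑b) → ⊑-trans a⊑b b⊑c , ⊑-trans c⊑b b⊑a
      }
    ; cong-or   = λ p (a⊑ , ⊒a) (b⊑ , ⊒b) → or-mono p a⊑ b⊑ , or-mono p ⊒a ⊒b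
    ; cong-and  = λ p (a⊑ , ⊒a) (b⊑ , ⊒b) → and-mono p a⊑ b⊑ , and-mono p ⊒a ⊒b
    ; cong-prod = λ p (a⊑ , ⊒a) (b⊑ , ⊒b) → prod-mono p a⊑ b⊑ , prod-mono p ⊒a ⊒b
    ; cong-ldiv = λ p (a⊑ , ⊒a) (b⊑ , ⊒b) → ldiv-mono p ⊒a b⊑ , ldiv-mono p a⊑ ⊒b
    ; cong-rdiv = λ p (a⊑ , ⊒a) (b⊑ , ⊒b) → rdiv-mono p a⊑ ⊒b , rdiv-mono p ⊒a b⊑
    ; cong-negr = λ p (a⊑ , ⊒a) → negr-anti p ⊒a , negr-anti p a⊑
    ; cong-negl = λ p (a⊑ , ⊒a) → negl-anti p ⊒a , negl-anti p a⊑
    }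

IsCongruence-resp-⇔ : ∀ {Ψ} {θ θ' : Fm Ψ → Fm Ψ → Set}
  → (∀ {a b} → θ a b ⇔ θ' a b) → IsCongruence θ → IsCongruence θ'
IsCongruence-resp-⇔ {θ = θ} {θ'} θ⇔θ' c = record
  { isEquivalence = record
    { refl  = to refl
    ; sym   = λ r → to (sym (from r))
    ; trans = λ r s → to (trans (from r) (from s))
    }
  ; cong-or   = λ p r s → to (cong-or p (from r) (from s))
  ; cong-and  = λ p r s → to (cong-and p (from r) (from s))
  ; cong-prod = λ p r s → to (cong-prod p (from r) (from s))
  ; cong-ldiv = λ p r s → to (cong-ldiv p (from r) (from s))
  ; cong-rdiv = λ p r s → to (cong-rdiv p (from r) (from s))
  ; cong-negr = λ p r → to (cong-negr p (from r))
  ; cong-negl = λ p r → to (cong-negl p (from r))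
  }
  where
  open IsCongruence c
  open IsEquivalence isEquivalence using (refl; sym; trans)
  to : ∀ {a b} → θ a b → θ' a b
  to = Equivalence.to θ⇔θ'
  from : ∀ {a b} → θ' a b → θ a b
  from = Equivalence.from θ⇔θ'

axiomsOf : ∀ {Ψ} → (Fm Ψ → Set) → Seq Ψ → Set
axiomsOf Th s = ∃ λ a → Th a × (s ≡ ([] ⇒ just a))

module TheoryOf {Ψ : Lang} {Th : Fm Ψ → Set} (isTheory : IsTheory Th) where

  open Derivability (axiomsOf Th) public

  derive : ∀ {a} → Th a → axiomsOf Th ⊢G ([] ⇒ just a)
  derive {a} a∈Th = hyp (a , a∈Th , ≡.refl)

  ldiv∈⇔⊑ : ∀ p {a b} → Th (ldiv p a b) ⇔ a ⊑ b
  ldiv∈⇔⊑ p = mk⇔ (λ t → ldiv⇒⊑ p (derive t)) (λ a⊑b → isTheory _ (ldivR p a⊑b))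

  ldiv-refl : ∀ p a → Th (ldiv p a a)
  ldiv-refl p a = Equivalence.from (ldiv∈⇔⊑ p) (ax a)

  ldiv-mp : ∀ p {a b} → Th (ldiv p a b) → Th a → Th b
  ldiv-mp p a\b∈Th a∈Th =
    isTheory _ (modus-ponens (derive a∈Th) (Equivalence.to (ldiv∈⇔⊑ p) a\b∈Th))

corollary7 : (Ψ : Lang) → (p : T (hasLdiv Ψ)) → (Th : Fm Ψ → Set) → IsTheory Th
    → IsLeibnizCongruence Th (λ φ ψ → Th (ldiv p φ ψ) × Th (ldiv p ψ φ))
corollary7 Ψ p Th isTheory = isCongruence , compatible , largest
  where
  open TheoryOf isTheory

  Ω : Fm Ψ → Fm Ψ → Set
  Ω φ ψ = Th (ldiv p φ ψ) × Th (ldiv p ψ φ)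

  isCongruence : IsCongruence Ω
  isCongruence = IsCongruence-resp-⇔
    (mk⇔ (map (Equivalence.from (ldiv∈⇔⊑ p)) (Equivalence.from (ldiv∈⇔⊑ p)))
         (map (Equivalence.to (ldiv∈⇔⊑ p)) (Equivalence.to (ldiv∈⇔⊑ p))))
    ≋-isCongruence

  compatible : Compatible Th Ω
  compatible (φ\ψ∈Th , _) = ldiv-mp p φ\ψ∈Th

  largest : ∀ θ → IsCongruence θ → Compatible Th θ
    → ∀ {φ ψ} → θ φ ψ → Ω φ ψ
  largest θ c θ-compatible {φ} {ψ} φθψ =
      θ-compatible (cong-ldiv p refl φθψ) (ldiv-refl p φ)
    , θ-compatible (cong-ldiv p refl (sym φθψ)) (ldiv-refl p ψ)
    where
    open IsCongruence c
    open IsEquivalence isEquivalence
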